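{- For every integer $k>1$, \[\sum_{n=1}^{\infty}\frac{1}{T_k(n)}=\sum_{n=1}^{\infty} \frac{k!}{n(n+1)\cdots(n+k-1)} = \sum_{j=1}^{k} C_j \frac{k!}{(k-j)!}.\]
   Context: The generalized triangular numbers are defined by $T_0(n)=1$ for all positive integers $n$, and $T_k(n)=\sum_{i=1}^{n} T_{k-1}(i)$ for $k\ge 1$; equivalently $T_k(n)=\frac{n(n+1)\cdots(n+k-1)}{k!}$. Let $H_0=0$ and $H_\ell=\sum_{i=1}^{\ell}\frac{1}{i}$ for $\ell\ge 1$. For every integer $j\geq 1$, define $C_j=\frac{(-1)^j}{(j-1)!}H_{j-1}$. -}

module Defs where

open import Data.Nat as ℕ using (ℕ; zero; suc; _!; _∸_)
open import Data.Nat.Properties using (_!≢0)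
open import Data.Integer as ℤ using (+_; -[1+_])
open import Data.Rational using (ℚ; 0ℚ; 1ℚ; _+_; _*_; _-_; _/_; ∣_∣; _<_; _≤_; -_)
open import Data.Product using (∃-syntax)

Σ₁ : ℕ → (ℕ → ℚ) → ℚ
Σ₁ zero    f = 0ℚ
Σ₁ (suc n) f = Σ₁ n f + f (suc n)

Σℕ : ℕ → (ℕ → ℕ) → ℕ
Σℕ zero    f = 0
Σℕ (suc n) f = Σℕ n f ℕ.+ f (suc n)

T : ℕ → ℕ → ℕ
T zero    n = 1
T (suc k) n = Σℕ n (T k)

rising : ℕ → ℕ → ℕ
rising n zero    = 1
rising n (suc k) = rising n k ℕ.* (n ℕ.+ k)

-- reciprocal of a natural number as a rational (1/m for m ≥ 1; the value at 0 is
-- an arbitrary convention and is never used: all denominators below are ≥ 1)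
recip : ℕ → ℚ
recip zero    = 0ℚ
recip (suc m) = + 1 / suc m

ℕ→ℚ : ℕ → ℚ
ℕ→ℚ n = + n / 1

H : ℕ → ℚ
H ℓ = Σ₁ ℓ recip

sgn : ℕ → ℚ
sgn zero    = 1ℚ
sgn (suc j) = - sgn j

-- C_j = (-1)^j / (j-1)! · H_{j-1}   (used for j ≥ 1)
C : ℕ → ℚ
C j = sgn j * (+ 1 / ((j ∸ 1) !)) {{(j ∸ 1) !≢0}} * H (j ∸ 1)

-- k! / (k-j)!  as a rational (used for 1 ≤ j ≤ k)
fallingℚ : ℕ → ℕ → ℚ
fallingℚ k j = (+ (k !) / ((k ∸ j) !)) {{(k ∸ j) !≢0}}

-- The sequence of partial sums s converges (in ℚ, hence in ℝ) to the rational L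
ConvergesTo : (ℕ → ℚ) → ℚ → Set
ConvergesTo s L = ∀ (ε : ℚ) → 0ℚ < ε → ∃[ N ] (∀ M → N ℕ.≤ M → ∣ s M - L ∣ < ε)

module Submission where

-- T_k(n) k! = n(n+1)⋯(n+k-1), and with k = r + 1 the terms telescope:
--   r / (n⋯(n+r)) = 1/(n⋯(n+r-1)) - 1/((n+1)⋯(n+r)),
-- so the partial sums tend to k!/(r·r!) = k/r with an error of order 1/N.
-- On the other side, C_{i+1} k!/(r-i)! = -k (-1)^i binom(r,i) H_i, and Pascal's rule
-- together with Σ_i binom(m,i) (-1)^i/(i+1) = 1/(m+1) gives
-- Σ_i binom(r,i) (-1)^i H_i = -1/r for r ≥ 1, so that side equals k/r as well.

open import Defs
open import Data.Nat as ℕ using (ℕ; zero; suc; _!; _∸_; z≤n; s≤s)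
import Data.Nat.Properties as ℕ
open import Data.Nat.Combinatorics
  using (nCk≡nC[n∸k]; nCn≡1; nC1≡n; nCk≡n!/k![n-k]!; k>n⇒nCk≡0; k![n∸k]!∣n!; nCk+nC[k+1]≡[n+1]C[k+1])
  renaming (_C_ to _choose_)
open import Data.Nat.DivMod using (m/n*n≡m)
open import Data.Integer as ℤ using (+_)
import Data.Integer.Properties as ℤ
open import Data.Rational
open import Data.Rational.Properties
import Data.Rational.Unnormalised as ℚᵘ
import Data.Rational.Unnormalised.Properties as ℚᵘ
open import Data.Rational.Solver using (module +-*-Solver)
open import Algebra.Properties.Group +-0-group using (x∙y⁻¹≈ε⇒x≈y)
open import Algebra.Properties.CommutativeSemigroup ℕ.*-commutativeSemigroup using (x∙yz≈y∙xz)
open import Data.Product using (_×_; _,_)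
open import Data.Empty using (⊥-elim)
open import Function using (_∘_)
open import Relation.Binary.PropositionalEquality

open +-*-Solver
open ≡-Reasoning

fromℚᵘ-homo-+ : ∀ p q → fromℚᵘ (p ℚᵘ.+ q) ≡ fromℚᵘ p + fromℚᵘ q
fromℚᵘ-homo-+ p q = toℚᵘ-injective (ℚᵘ.≃-trans (toℚᵘ-fromℚᵘ (p ℚᵘ.+ q)) (ℚᵘ.≃-sym
  (ℚᵘ.≃-trans (toℚᵘ-homo-+ (fromℚᵘ p) (fromℚᵘ q)) (ℚᵘ.+-cong (toℚᵘ-fromℚᵘ p) (toℚᵘ-fromℚᵘ q)))))

fromℚᵘ-homo-* : ∀ p q → fromℚᵘ (p ℚᵘ.* q) ≡ fromℚᵘ p * fromℚᵘ q
fromℚᵘ-homo-* p q = toℚᵘ-injective (ℚᵘ.≃-trans (toℚᵘ-fromℚᵘ (p ℚᵘ.* q)) (ℚᵘ.≃-sym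
  (ℚᵘ.≃-trans (toℚᵘ-homo-* (fromℚᵘ p) (fromℚᵘ q)) (ℚᵘ.*-cong (toℚᵘ-fromℚᵘ p) (toℚᵘ-fromℚᵘ q)))))

ℕ→ℚ-+ : ∀ a b → ℕ→ℚ (a ℕ.+ b) ≡ ℕ→ℚ a + ℕ→ℚ b
ℕ→ℚ-+ a b = trans (cong (_/ 1) ℤ-eq) (fromℚᵘ-homo-+ (ℚᵘ.mkℚᵘ (+ a) 0) (ℚᵘ.mkℚᵘ (+ b) 0))
  where
  ℤ-eq : + (a ℕ.+ b) ≡ + a ℤ.* + 1 ℤ.+ + b ℤ.* + 1
  ℤ-eq = sym (cong₂ ℤ._+_ (ℤ.*-identityʳ (+ a)) (ℤ.*-identityʳ (+ b)))

ℕ→ℚ-* : ∀ a b → ℕ→ℚ (a ℕ.* b) ≡ ℕ→ℚ a * ℕ→ℚ b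
ℕ→ℚ-* a b = trans (cong (_/ 1) (ℤ.pos-* a b)) (fromℚᵘ-homo-* (ℚᵘ.mkℚᵘ (+ a) 0) (ℚᵘ.mkℚᵘ (+ b) 0))

a/c*b/d≡[a*b]/[c*d] : ∀ a b c d .{{_ : ℕ.NonZero c}} .{{_ : ℕ.NonZero d}} →
                      (+ a / c) * (+ b / d) ≡ (+ (a ℕ.* b) / (c ℕ.* d)) {{ℕ.m*n≢0 c d}}
a/c*b/d≡[a*b]/[c*d] a b (suc c) (suc d) =
  trans (sym (fromℚᵘ-homo-* (ℚᵘ.mkℚᵘ (+ a) c) (ℚᵘ.mkℚᵘ (+ b) d))) (cong (_/ _) (sym (ℤ.pos-* a b)))

a/d≡ℕ→ℚa*recipd : ∀ a d .{{_ : ℕ.NonZero d}} → + a / d ≡ ℕ→ℚ a * recip d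
a/d≡ℕ→ℚa*recipd a (suc d) = trans (/-cong (sym (ℤ.*-identityʳ (+ a))) (cong suc (sym (ℕ.+-identityʳ d))))
                                  (fromℚᵘ-homo-* (ℚᵘ.mkℚᵘ (+ a) 0) (ℚᵘ.mkℚᵘ (+ 1) d))

recip-* : ∀ m n .{{_ : ℕ.NonZero m}} .{{_ : ℕ.NonZero n}} → recip (m ℕ.* n) ≡ recip m * recip n
recip-* (suc m) (suc n) = fromℚᵘ-homo-* (ℚᵘ.mkℚᵘ (+ 1) m) (ℚᵘ.mkℚᵘ (+ 1) n)

a*e≡b*d⇒a/d≡b/e : ∀ a b d e .{{_ : ℕ.NonZero d}} .{{_ : ℕ.NonZero e}} →
                  a ℕ.* e ≡ b ℕ.* d → + a / d ≡ + b / e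
a*e≡b*d⇒a/d≡b/e a b (suc d) (suc e) eq = fromℚᵘ-cong {ℚᵘ.mkℚᵘ (+ a) d} {ℚᵘ.mkℚᵘ (+ b) e}
  (ℚᵘ.*≡* (trans (sym (ℤ.pos-* a (suc e))) (trans (cong +_ eq) (ℤ.pos-* b (suc d)))))

a*e≤b*d⇒a/d≤b/e : ∀ a b d e .{{_ : ℕ.NonZero d}} .{{_ : ℕ.NonZero e}} →
                  a ℕ.* e ℕ.≤ b ℕ.* d → + a / d ≤ + b / e
a*e≤b*d⇒a/d≤b/e a b (suc d) (suc e) le = toℚᵘ-cancel-≤
  (ℚᵘ.≤-respʳ-≃ (ℚᵘ.≃-sym (toℚᵘ-fromℚᵘ (ℚᵘ.mkℚᵘ (+ b) e))) (ℚᵘ.≤-respˡ-≃ (ℚᵘ.≃-sym (toℚᵘ-fromℚᵘ (ℚᵘ.mkℚᵘ (+ a) d)))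
    (ℚᵘ.*≤* (subst₂ ℤ._≤_ (ℤ.pos-* a (suc e)) (ℤ.pos-* b (suc d)) (ℤ.+≤+ le)))))

a*e<b*d⇒a/d<b/e : ∀ a b d e .{{_ : ℕ.NonZero d}} .{{_ : ℕ.NonZero e}} →
                  a ℕ.* e ℕ.< b ℕ.* d → + a / d < + b / e
a*e<b*d⇒a/d<b/e a b (suc d) (suc e) lt = toℚᵘ-cancel-<
  (ℚᵘ.<-respʳ-≃ (ℚᵘ.≃-sym (toℚᵘ-fromℚᵘ (ℚᵘ.mkℚᵘ (+ b) e))) (ℚᵘ.<-respˡ-≃ (ℚᵘ.≃-sym (toℚᵘ-fromℚᵘ (ℚᵘ.mkℚᵘ (+ a) d)))
    (ℚᵘ.*<* (subst₂ ℤ._<_ (ℤ.pos-* a (suc e)) (ℤ.pos-* b (suc d)) (ℤ.+<+ lt)))))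

ℕ→ℚ*recip≡1 : ∀ n .{{_ : ℕ.NonZero n}} → ℕ→ℚ n * recip n ≡ 1ℚ
ℕ→ℚ*recip≡1 n = trans (sym (a/d≡ℕ→ℚa*recipd n n)) (a*e≡b*d⇒a/d≡b/e n 1 n 1 (ℕ.*-comm n 1))

recip≡ℕ→ℚ*recip[*] : ∀ a c .{{_ : ℕ.NonZero a}} .{{_ : ℕ.NonZero c}} →
                     recip a ≡ ℕ→ℚ c * recip (a ℕ.* c)
recip≡ℕ→ℚ*recip[*] a c = begin
  recip a                              ≡⟨ *-identityʳ (recip a) ⟨
  recip a * 1ℚ                         ≡⟨ cong (recip a *_) (ℕ→ℚ*recip≡1 c) ⟨
  recip a * (ℕ→ℚ c * recip c)          ≡⟨ solve 3 (λ x y z → x :* (y :* z) := y :* (x :* z)) refl (recip a) (ℕ→ℚ c) (recip c) ⟩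
  ℕ→ℚ c * (recip a * recip c)          ≡⟨ cong (ℕ→ℚ c *_) (recip-* a c) ⟨
  ℕ→ℚ c * recip (a ℕ.* c)              ∎

Σ₀ : ℕ → (ℕ → ℚ) → ℚ
Σ₀ zero    f = 0ℚ
Σ₀ (suc n) f = f 0 + Σ₀ n (f ∘ suc)

Σ₀-cong : ∀ n {f g : ℕ → ℚ} → (∀ i → i ℕ.< n → f i ≡ g i) → Σ₀ n f ≡ Σ₀ n g
Σ₀-cong zero    f≡g = refl
Σ₀-cong (suc n) f≡g = cong₂ _+_ (f≡g 0 (s≤s z≤n)) (Σ₀-cong n (λ i i<n → f≡g (suc i) (s≤s i<n)))

Σ₀-distrib-+ : ∀ n (f g : ℕ → ℚ) → Σ₀ n (λ i → f i + g i) ≡ Σ₀ n f + Σ₀ n g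
Σ₀-distrib-+ zero    f g = refl
Σ₀-distrib-+ (suc n) f g = begin
  (f 0 + g 0) + Σ₀ n (λ i → f (suc i) + g (suc i))      ≡⟨ cong (_+_ (f 0 + g 0)) (Σ₀-distrib-+ n (f ∘ suc) (g ∘ suc)) ⟩
  (f 0 + g 0) + (Σ₀ n (f ∘ suc) + Σ₀ n (g ∘ suc))       ≡⟨ solve 4 (λ a b c d → (a :+ b) :+ (c :+ d) := (a :+ c) :+ (b :+ d)) refl (f 0) (g 0) _ _ ⟩
  (f 0 + Σ₀ n (f ∘ suc)) + (g 0 + Σ₀ n (g ∘ suc))       ∎

Σ₀-distrib-- : ∀ n (f : ℕ → ℚ) → Σ₀ n (λ i → - f i) ≡ - Σ₀ n f
Σ₀-distrib-- zero    f = refl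
Σ₀-distrib-- (suc n) f = trans (cong (_+_ (- f 0)) (Σ₀-distrib-- n (f ∘ suc))) (sym (neg-distrib-+ (f 0) _))

Σ₀-*ˡ : ∀ n c (f : ℕ → ℚ) → Σ₀ n (λ i → c * f i) ≡ c * Σ₀ n f
Σ₀-*ˡ zero    c f = sym (*-zeroʳ c)
Σ₀-*ˡ (suc n) c f = trans (cong (_+_ (c * f 0)) (Σ₀-*ˡ n c (f ∘ suc))) (sym (*-distribˡ-+ c (f 0) _))

Σ₀-snoc : ∀ n (f : ℕ → ℚ) → Σ₀ (suc n) f ≡ Σ₀ n f + f n
Σ₀-snoc zero    f = trans (+-identityʳ (f 0)) (sym (+-identityˡ (f 0)))
Σ₀-snoc (suc n) f = trans (cong (_+_ (f 0)) (Σ₀-snoc n (f ∘ suc))) (sym (+-assoc (f 0) _ _))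

Σ₁≡Σ₀ : ∀ n (f : ℕ → ℚ) → Σ₁ n f ≡ Σ₀ n (f ∘ suc)
Σ₁≡Σ₀ zero    f = refl
Σ₁≡Σ₀ (suc n) f = trans (cong (_+ f (suc n)) (Σ₁≡Σ₀ n f)) (sym (Σ₀-snoc n (f ∘ suc)))

Σ₁-cong : ∀ n {f g : ℕ → ℚ} → (∀ i → f (suc i) ≡ g (suc i)) → Σ₁ n f ≡ Σ₁ n g
Σ₁-cong zero    f≡g = refl
Σ₁-cong (suc n) f≡g = cong₂ _+_ (Σ₁-cong n f≡g) (f≡g n)

Σ₁-telescope : ∀ n (f : ℕ → ℚ) → Σ₁ n (λ i → f i - f (suc i)) ≡ f 1 - f (suc n)
Σ₁-telescope zero    f = sym (+-inverseʳ (f 1))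
Σ₁-telescope (suc n) f = begin
  Σ₁ n (λ i → f i - f (suc i)) + (f (suc n) - f (suc (suc n)))
    ≡⟨ cong (_+ (f (suc n) - f (suc (suc n)))) (Σ₁-telescope n f) ⟩
  (f 1 - f (suc n)) + (f (suc n) - f (suc (suc n)))
    ≡⟨ solve 3 (λ a b c → (a :- b) :+ (b :- c) := a :- c) refl (f 1) (f (suc n)) (f (suc (suc n))) ⟩
  f 1 - f (suc (suc n)) ∎

nC0≡1 : ∀ n → n choose 0 ≡ 1
nC0≡1 n = trans (nCk≡nC[n∸k] {n = n} z≤n) (nCn≡1 n)

nCk*[k!*[n∸k]!]≡n! : ∀ {n k} → k ℕ.≤ n → (n choose k) ℕ.* (k ! ℕ.* (n ∸ k) !) ≡ n !
nCk*[k!*[n∸k]!]≡n! {n} {k} k≤n = trans (cong (ℕ._* (k ! ℕ.* (n ∸ k) !)) (nCk≡n!/k![n-k]! k≤n))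
                                       (m/n*n≡m {{k ℕ.!* (n ∸ k) !≢0}} (k![n∸k]!∣n! k≤n))

[1+k]*[1+n]C[1+k]≡[1+n]*nCk : ∀ n k → suc k ℕ.* (suc n choose suc k) ≡ suc n ℕ.* (n choose k)
[1+k]*[1+n]C[1+k]≡[1+n]*nCk zero    zero    = cong (1 ℕ.*_) (trans (nCn≡1 1) (sym (nCn≡1 0)))
[1+k]*[1+n]C[1+k]≡[1+n]*nCk zero    (suc k) =
  trans (cong (suc (suc k) ℕ.*_) (k>n⇒nCk≡0 {1} {suc (suc k)} (s≤s (s≤s z≤n)))) (ℕ.*-zeroʳ (suc (suc k)))
[1+k]*[1+n]C[1+k]≡[1+n]*nCk (suc n) zero    = begin
  1 ℕ.* (suc (suc n) choose 1)       ≡⟨ ℕ.*-identityˡ _ ⟩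
  suc (suc n) choose 1               ≡⟨ nC1≡n (suc (suc n)) ⟩
  suc (suc n)                        ≡⟨ ℕ.*-identityʳ (suc (suc n)) ⟨
  suc (suc n) ℕ.* 1                  ≡⟨ cong (suc (suc n) ℕ.*_) (nC0≡1 (suc n)) ⟨
  suc (suc n) ℕ.* (suc n choose 0)   ∎
[1+k]*[1+n]C[1+k]≡[1+n]*nCk (suc n) (suc k) = begin
  suc (suc k) ℕ.* (suc (suc n) choose suc (suc k))
    ≡⟨ cong (suc (suc k) ℕ.*_) (nCk+nC[k+1]≡[n+1]C[k+1] (suc n) (suc k)) ⟨
  suc (suc k) ℕ.* (A ℕ.+ suc n choose suc (suc k))
    ≡⟨ ℕ.*-distribˡ-+ (suc (suc k)) A _ ⟩
  A ℕ.+ suc k ℕ.* A ℕ.+ suc (suc k) ℕ.* (suc n choose suc (suc k))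
    ≡⟨ cong₂ (λ x y → A ℕ.+ x ℕ.+ y) ([1+k]*[1+n]C[1+k]≡[1+n]*nCk n k) ([1+k]*[1+n]C[1+k]≡[1+n]*nCk n (suc k)) ⟩
  A ℕ.+ suc n ℕ.* (n choose k) ℕ.+ suc n ℕ.* (n choose suc k)
    ≡⟨ ℕ.+-assoc A _ _ ⟩
  A ℕ.+ (suc n ℕ.* (n choose k) ℕ.+ suc n ℕ.* (n choose suc k))
    ≡⟨ cong (A ℕ.+_) (ℕ.*-distribˡ-+ (suc n) (n choose k) (n choose suc k)) ⟨
  A ℕ.+ suc n ℕ.* (n choose k ℕ.+ n choose suc k)
    ≡⟨ cong (λ x → A ℕ.+ suc n ℕ.* x) (nCk+nC[k+1]≡[n+1]C[k+1] n k) ⟩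
  suc (suc n) ℕ.* A ∎
  where
  A : ℕ
  A = suc n choose suc k

-- Binomial transforms Σ_{i ≤ m} binom(m,i) f(i)

binomial : ℕ → ℕ → ℚ
binomial m i = ℕ→ℚ (m choose i)

binomialSum : ℕ → (ℕ → ℚ) → ℚ
binomialSum m f = Σ₀ (suc m) (λ i → binomial m i * f i)

binomialSum-cong : ∀ m {f g : ℕ → ℚ} → (∀ i → f i ≡ g i) → binomialSum m f ≡ binomialSum m g
binomialSum-cong m f≡g = Σ₀-cong (suc m) (λ i _ → cong (binomial m i *_) (f≡g i))

binomialSum-distrib-+ : ∀ m (f g : ℕ → ℚ) → binomialSum m (λ i → f i + g i) ≡ binomialSum m f + binomialSum m g
binomialSum-distrib-+ m f g = trans (Σ₀-cong (suc m) (λ i _ → *-distribˡ-+ (binomial m i) (f i) (g i)))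
                                    (Σ₀-distrib-+ (suc m) (λ i → binomial m i * f i) (λ i → binomial m i * g i))

binomialSum-distrib-- : ∀ m (f : ℕ → ℚ) → binomialSum m (λ i → - f i) ≡ - binomialSum m f
binomialSum-distrib-- m f = trans (Σ₀-cong (suc m) (λ i _ → sym (neg-distribʳ-* (binomial m i) (f i))))
                                  (Σ₀-distrib-- (suc m) (λ i → binomial m i * f i))

binomial-0 : ∀ m → binomial m 0 ≡ 1ℚ
binomial-0 m = cong ℕ→ℚ (nC0≡1 m)

binomialSum-uncons : ∀ m (f : ℕ → ℚ) → binomialSum m f ≡ f 0 + Σ₀ m (λ i → binomial m (suc i) * f (suc i))
binomialSum-uncons m f = cong (_+ Σ₀ m (λ i → binomial m (suc i) * f (suc i)))
                              (trans (cong (_* f 0) (binomial-0 m)) (*-identityˡ (f 0)))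

binomialSum-pascal : ∀ m (f : ℕ → ℚ) → binomialSum (suc m) f ≡ binomialSum m f + binomialSum m (f ∘ suc)
binomialSum-pascal m f = begin
  binomialSum (suc m) f
    ≡⟨ binomialSum-uncons (suc m) f ⟩
  f 0 + Σ₀ (suc m) (λ i → binomial (suc m) (suc i) * f (suc i))
    ≡⟨ cong (_+_ (f 0)) (Σ₀-cong (suc m) (λ i _ → pascal i)) ⟩
  f 0 + Σ₀ (suc m) (λ i → binomial m i * f (suc i) + binomial m (suc i) * f (suc i))
    ≡⟨ cong (_+_ (f 0)) (Σ₀-distrib-+ (suc m) (λ i → binomial m i * f (suc i)) (λ i → binomial m (suc i) * f (suc i))) ⟩
  f 0 + (binomialSum m (f ∘ suc) + Σ₀ (suc m) (λ i → binomial m (suc i) * f (suc i)))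
    ≡⟨ cong (λ x → f 0 + (binomialSum m (f ∘ suc) + x)) top-term-vanishes ⟩
  f 0 + (binomialSum m (f ∘ suc) + Z)
    ≡⟨ solve 3 (λ a b z → a :+ (b :+ z) := (a :+ z) :+ b) refl (f 0) (binomialSum m (f ∘ suc)) Z ⟩
  (f 0 + Z) + binomialSum m (f ∘ suc)
    ≡⟨ cong (_+ binomialSum m (f ∘ suc)) (binomialSum-uncons m f) ⟨
  binomialSum m f + binomialSum m (f ∘ suc) ∎
  where
  Z : ℚ
  Z = Σ₀ m (λ i → binomial m (suc i) * f (suc i))

  pascal : ∀ i → binomial (suc m) (suc i) * f (suc i) ≡ binomial m i * f (suc i) + binomial m (suc i) * f (suc i)
  pascal i = begin
    binomial (suc m) (suc i) * f (suc i)
      ≡⟨ cong (λ x → ℕ→ℚ x * f (suc i)) (nCk+nC[k+1]≡[n+1]C[k+1] m i) ⟨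
    ℕ→ℚ (m choose i ℕ.+ m choose suc i) * f (suc i)
      ≡⟨ cong (_* f (suc i)) (ℕ→ℚ-+ (m choose i) (m choose suc i)) ⟩
    (binomial m i + binomial m (suc i)) * f (suc i)
      ≡⟨ *-distribʳ-+ (f (suc i)) (binomial m i) (binomial m (suc i)) ⟩
    binomial m i * f (suc i) + binomial m (suc i) * f (suc i) ∎

  top-term-vanishes : Σ₀ (suc m) (λ i → binomial m (suc i) * f (suc i)) ≡ Z
  top-term-vanishes = begin
    Σ₀ (suc m) (λ i → binomial m (suc i) * f (suc i))   ≡⟨ Σ₀-snoc m (λ i → binomial m (suc i) * f (suc i)) ⟩
    Z + ℕ→ℚ (m choose suc m) * f (suc m)                ≡⟨ cong (λ x → Z + ℕ→ℚ x * f (suc m)) (k>n⇒nCk≡0 (ℕ.n<1+n m)) ⟩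
    Z + 0ℚ * f (suc m)                                  ≡⟨ solve 2 (λ z y → z :+ con 0ℚ :* y := z) refl Z (f (suc m)) ⟩
    Z                                                   ∎

binomial-absorption : ∀ m i → binomial m i * recip (suc i) ≡ binomial (suc m) (suc i) * recip (suc m)
binomial-absorption m i = begin
  binomial m i * recip (suc i)                ≡⟨ a/d≡ℕ→ℚa*recipd (m choose i) (suc i) ⟨
  + (m choose i) / suc i                      ≡⟨ a*e≡b*d⇒a/d≡b/e (m choose i) (suc m choose suc i) (suc i) (suc m) cross ⟩
  + (suc m choose suc i) / suc m              ≡⟨ a/d≡ℕ→ℚa*recipd (suc m choose suc i) (suc m) ⟩
  binomial (suc m) (suc i) * recip (suc m)    ∎
  where
  cross : (m choose i) ℕ.* suc m ≡ (suc m choose suc i) ℕ.* suc i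
  cross = trans (ℕ.*-comm (m choose i) (suc m))
                (trans (sym ([1+k]*[1+n]C[1+k]≡[1+n]*nCk m i)) (ℕ.*-comm (suc i) (suc m choose suc i)))

binomialSum-sgn : ∀ m → binomialSum (suc m) sgn ≡ 0ℚ
binomialSum-sgn m = begin
  binomialSum (suc m) sgn                                ≡⟨ binomialSum-pascal m sgn ⟩
  binomialSum m sgn + binomialSum m (λ i → - sgn i)      ≡⟨ cong (_+_ (binomialSum m sgn)) (binomialSum-distrib-- m sgn) ⟩
  binomialSum m sgn - binomialSum m sgn                  ≡⟨ +-inverseʳ (binomialSum m sgn) ⟩
  0ℚ                                                     ∎

binomialSum-sgn*recip[1+i] : ∀ m → binomialSum m (λ i → sgn i * recip (suc i)) ≡ recip (suc m)
binomialSum-sgn*recip[1+i] m = begin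
  binomialSum m (λ i → sgn i * recip (suc i))
    ≡⟨ Σ₀-cong (suc m) (λ i _ → absorb i) ⟩
  Σ₀ (suc m) (λ i → recip (suc m) * (binomial (suc m) (suc i) * sgn i))
    ≡⟨ Σ₀-*ˡ (suc m) (recip (suc m)) (λ i → binomial (suc m) (suc i) * sgn i) ⟩
  recip (suc m) * Z
    ≡⟨ cong (recip (suc m) *_) (sym (x∙y⁻¹≈ε⇒x≈y 1ℚ Z 1-Z≡0)) ⟩
  recip (suc m) * 1ℚ
    ≡⟨ *-identityʳ (recip (suc m)) ⟩
  recip (suc m) ∎
  where
  Z : ℚ
  Z = Σ₀ (suc m) (λ i → binomial (suc m) (suc i) * sgn i)

  absorb : ∀ i → binomial m i * (sgn i * recip (suc i)) ≡ recip (suc m) * (binomial (suc m) (suc i) * sgn i)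
  absorb i = begin
    binomial m i * (sgn i * recip (suc i))                ≡⟨ solve 3 (λ b s r → b :* (s :* r) := (b :* r) :* s) refl (binomial m i) (sgn i) (recip (suc i)) ⟩
    (binomial m i * recip (suc i)) * sgn i                ≡⟨ cong (_* sgn i) (binomial-absorption m i) ⟩
    (binomial (suc m) (suc i) * recip (suc m)) * sgn i    ≡⟨ solve 3 (λ b s r → (b :* r) :* s := r :* (b :* s)) refl (binomial (suc m) (suc i)) (sgn i) (recip (suc m)) ⟩
    recip (suc m) * (binomial (suc m) (suc i) * sgn i)    ∎

  1-Z≡0 : 1ℚ - Z ≡ 0ℚ
  1-Z≡0 = begin
    1ℚ - Z                                                                  ≡⟨ cong (_+_ 1ℚ) (Σ₀-distrib-- (suc m) (λ i → binomial (suc m) (suc i) * sgn i)) ⟨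
    1ℚ + Σ₀ (suc m) (λ i → - (binomial (suc m) (suc i) * sgn i))            ≡⟨ cong (_+_ 1ℚ) (Σ₀-cong (suc m) (λ i _ → neg-distribʳ-* (binomial (suc m) (suc i)) (sgn i))) ⟩
    1ℚ + Σ₀ (suc m) (λ i → binomial (suc m) (suc i) * - sgn i)              ≡⟨ binomialSum-uncons (suc m) sgn ⟨
    binomialSum (suc m) sgn                                                 ≡⟨ binomialSum-sgn m ⟩
    0ℚ                                                                      ∎

binomialSum-sgn*H : ∀ m → binomialSum (suc m) (λ i → sgn i * H i) ≡ - recip (suc m)
binomialSum-sgn*H m = begin
  binomialSum (suc m) u
    ≡⟨ binomialSum-pascal m u ⟩
  binomialSum m u + binomialSum m (u ∘ suc)
    ≡⟨ cong (_+_ (binomialSum m u)) (binomialSum-cong m u[1+i]) ⟩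
  binomialSum m u + binomialSum m (λ i → - (u i + v i))
    ≡⟨ cong (_+_ (binomialSum m u)) (binomialSum-distrib-- m (λ i → u i + v i)) ⟩
  binomialSum m u + - binomialSum m (λ i → u i + v i)
    ≡⟨ cong (λ x → binomialSum m u + - x) (binomialSum-distrib-+ m u v) ⟩
  binomialSum m u + - (binomialSum m u + binomialSum m v)
    ≡⟨ solve 2 (λ x y → x :+ :- (x :+ y) := :- y) refl (binomialSum m u) (binomialSum m v) ⟩
  - binomialSum m v
    ≡⟨ cong -_ (binomialSum-sgn*recip[1+i] m) ⟩
  - recip (suc m) ∎
  where
  u v : ℕ → ℚ
  u i = sgn i * H i
  v i = sgn i * recip (suc i)

  u[1+i] : ∀ i → u (suc i) ≡ - (u i + v i)
  u[1+i] i = solve 3 (λ s h r → (:- s) :* (h :+ r) := :- (s :* h :+ s :* r)) refl (sgn i) (H i) (recip (suc i))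

-- The closed form of Σ_j C_j k!/(k-j)!

[1/i!]*[[1+m]!/[m∸i]!]≡[1+m]*binomial : ∀ {m i} → i ℕ.≤ m →
  (+ 1 / i !) {{i ℕ.!≢0}} * (+ (suc m !) / (m ∸ i) !) {{(m ∸ i) ℕ.!≢0}} ≡ ℕ→ℚ (suc m) * binomial m i
[1/i!]*[[1+m]!/[m∸i]!]≡[1+m]*binomial {m} {i} i≤m = begin
  (+ 1 / i !) * (+ (suc m !) / (m ∸ i) !)                  ≡⟨ a/c*b/d≡[a*b]/[c*d] 1 (suc m !) (i !) ((m ∸ i) !) ⟩
  + (1 ℕ.* suc m !) / (i ! ℕ.* (m ∸ i) !)                  ≡⟨ a*e≡b*d⇒a/d≡b/e (1 ℕ.* suc m !) (suc m ℕ.* (m choose i)) _ 1 cross ⟩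
  ℕ→ℚ (suc m ℕ.* (m choose i))                             ≡⟨ ℕ→ℚ-* (suc m) (m choose i) ⟩
  ℕ→ℚ (suc m) * binomial m i                               ∎
  where
  instance
    i!≢0 : ℕ.NonZero (i !)
    i!≢0 = i ℕ.!≢0
    [m∸i]!≢0 : ℕ.NonZero ((m ∸ i) !)
    [m∸i]!≢0 = (m ∸ i) ℕ.!≢0
    i![m∸i]!≢0 : ℕ.NonZero (i ! ℕ.* (m ∸ i) !)
    i![m∸i]!≢0 = i ℕ.!* (m ∸ i) !≢0

  cross : 1 ℕ.* suc m ! ℕ.* 1 ≡ suc m ℕ.* (m choose i) ℕ.* (i ! ℕ.* (m ∸ i) !)
  cross = begin
    1 ℕ.* suc m ! ℕ.* 1                                     ≡⟨ ℕ.*-identityʳ (1 ℕ.* suc m !) ⟩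
    1 ℕ.* suc m !                                           ≡⟨ ℕ.*-identityˡ (suc m !) ⟩
    suc m ℕ.* m !                                           ≡⟨ cong (suc m ℕ.*_) (nCk*[k!*[n∸k]!]≡n! i≤m) ⟨
    suc m ℕ.* ((m choose i) ℕ.* (i ! ℕ.* (m ∸ i) !))        ≡⟨ ℕ.*-assoc (suc m) (m choose i) _ ⟨
    suc m ℕ.* (m choose i) ℕ.* (i ! ℕ.* (m ∸ i) !)          ∎

C[1+i]*fallingℚ≡ : ∀ {m i} → i ℕ.≤ m →
  C (suc i) * fallingℚ (suc m) (suc i) ≡ - ℕ→ℚ (suc m) * (binomial m i * (sgn i * H i))
C[1+i]*fallingℚ≡ {m} {i} i≤m = begin
  ((- sgn i) * x * H i) * y                               ≡⟨ solve 4 (λ s x h y → ((:- s) :* x :* h) :* y := :- (x :* y) :* (s :* h)) refl (sgn i) x (H i) y ⟩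
  - (x * y) * (sgn i * H i)                               ≡⟨ cong (λ t → - t * (sgn i * H i)) ([1/i!]*[[1+m]!/[m∸i]!]≡[1+m]*binomial i≤m) ⟩
  - (ℕ→ℚ (suc m) * binomial m i) * (sgn i * H i)          ≡⟨ solve 3 (λ a b c → :- (a :* b) :* c := (:- a) :* (b :* c)) refl (ℕ→ℚ (suc m)) (binomial m i) (sgn i * H i) ⟩
  - ℕ→ℚ (suc m) * (binomial m i * (sgn i * H i))          ∎
  where
  x y : ℚ
  x = (+ 1 / i !) {{i ℕ.!≢0}}
  y = (+ (suc m !) / (m ∸ i) !) {{(m ∸ i) ℕ.!≢0}}

Σ₁-C*fallingℚ : ∀ m → Σ₁ (suc (suc m)) (λ j → C j * fallingℚ (suc (suc m)) j) ≡ ℕ→ℚ (suc (suc m)) * recip (suc m)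
Σ₁-C*fallingℚ m = begin
  Σ₁ (suc r) (λ j → C j * fallingℚ (suc r) j)                          ≡⟨ Σ₁≡Σ₀ (suc r) (λ j → C j * fallingℚ (suc r) j) ⟩
  Σ₀ (suc r) (λ i → C (suc i) * fallingℚ (suc r) (suc i))              ≡⟨ Σ₀-cong (suc r) (λ i i<1+r → C[1+i]*fallingℚ≡ (ℕ.≤-pred i<1+r)) ⟩
  Σ₀ (suc r) (λ i → - ℕ→ℚ (suc r) * (binomial r i * (sgn i * H i)))    ≡⟨ Σ₀-*ˡ (suc r) (- ℕ→ℚ (suc r)) (λ i → binomial r i * (sgn i * H i)) ⟩
  - ℕ→ℚ (suc r) * binomialSum r (λ i → sgn i * H i)                    ≡⟨ cong (- ℕ→ℚ (suc r) *_) (binomialSum-sgn*H m) ⟩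
  - ℕ→ℚ (suc r) * - recip r                                            ≡⟨ solve 2 (λ a b → (:- a) :* (:- b) := a :* b) refl (ℕ→ℚ (suc r)) (recip r) ⟩
  ℕ→ℚ (suc r) * recip r                                                ∎
  where
  r : ℕ
  r = suc m

-- Rising factorials and generalized triangular numbers

rising-shift : ∀ n k → n ℕ.* rising (suc n) k ≡ rising n (suc k)
rising-shift n zero    = trans (ℕ.*-identityʳ n) (sym (trans (ℕ.*-identityˡ (n ℕ.+ 0)) (ℕ.+-identityʳ n)))
rising-shift n (suc k) = begin
  n ℕ.* (rising (suc n) k ℕ.* (suc n ℕ.+ k))   ≡⟨ ℕ.*-assoc n (rising (suc n) k) _ ⟨
  n ℕ.* rising (suc n) k ℕ.* (suc n ℕ.+ k)     ≡⟨ cong₂ ℕ._*_ (rising-shift n k) (sym (ℕ.+-suc n k)) ⟩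
  rising n (suc k) ℕ.* (n ℕ.+ suc k)           ∎

rising-nonZero : ∀ n k → ℕ.NonZero (rising (suc n) k)
rising-nonZero n zero    = _
rising-nonZero n (suc k) = ℕ.m*n≢0 (rising (suc n) k) (suc n ℕ.+ k) {{rising-nonZero n k}}

rising-1 : ∀ k → rising 1 k ≡ k !
rising-1 zero    = refl
rising-1 (suc k) = trans (cong (ℕ._* suc k) (rising-1 k)) (ℕ.*-comm (k !) (suc k))

n≤rising : ∀ n k .{{_ : ℕ.NonZero k}} → suc n ℕ.≤ rising (suc n) k
n≤rising n (suc k) = ℕ.≤-trans (ℕ.m≤m+n (suc n) k) (ℕ.m≤n*m (suc n ℕ.+ k) (rising (suc n) k) {{rising-nonZero n k}})

T*k!≡rising : ∀ k n → T k n ℕ.* k ! ≡ rising n k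
T*k!≡rising zero    n       = refl
T*k!≡rising (suc k) zero    = rising-shift 0 k
T*k!≡rising (suc k) (suc n) = begin
  (T (suc k) n ℕ.+ T k (suc n)) ℕ.* suc k !                  ≡⟨ ℕ.*-distribʳ-+ (suc k !) (T (suc k) n) (T k (suc n)) ⟩
  T (suc k) n ℕ.* suc k ! ℕ.+ T k (suc n) ℕ.* (suc k ℕ.* k !) ≡⟨ cong (T (suc k) n ℕ.* suc k ! ℕ.+_) (x∙yz≈y∙xz (T k (suc n)) (suc k) (k !)) ⟩
  T (suc k) n ℕ.* suc k ! ℕ.+ suc k ℕ.* (T k (suc n) ℕ.* k !) ≡⟨ cong₂ (λ a b → a ℕ.+ suc k ℕ.* b) (T*k!≡rising (suc k) n) (T*k!≡rising k (suc n)) ⟩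
  rising n (suc k) ℕ.+ suc k ℕ.* R                            ≡⟨ cong (ℕ._+ suc k ℕ.* R) (rising-shift n k) ⟨
  n ℕ.* R ℕ.+ suc k ℕ.* R                                     ≡⟨ ℕ.*-distribʳ-+ R n (suc k) ⟨
  (n ℕ.+ suc k) ℕ.* R                                         ≡⟨ ℕ.*-comm (n ℕ.+ suc k) R ⟩
  R ℕ.* (n ℕ.+ suc k)                                         ≡⟨ cong (R ℕ.*_) (ℕ.+-suc n k) ⟩
  R ℕ.* (suc n ℕ.+ k)                                         ∎
  where
  R : ℕ
  R = rising (suc n) k

T-nonZero : ∀ k n → ℕ.NonZero (T k (suc n))
T-nonZero k n = ℕ.m*n≢0⇒m≢0 (T k (suc n)) {{subst ℕ.NonZero (sym (T*k!≡rising k (suc n))) (rising-nonZero n k)}}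

recip-T : ∀ k n → recip (T k (suc n)) ≡ ℕ→ℚ (k !) * recip (rising (suc n) k)
recip-T k n = trans (recip≡ℕ→ℚ*recip[*] (T k (suc n)) (k !) {{T-nonZero k n}} {{k ℕ.!≢0}})
                    (cong (λ t → ℕ→ℚ (k !) * recip t) (T*k!≡rising k (suc n)))

recip-rising-telescope : ∀ r n .{{_ : ℕ.NonZero r}} →
  recip (rising (suc n) (suc r)) ≡ recip r * (recip (rising (suc n) r) - recip (rising (suc (suc n)) r))
recip-rising-telescope r n = sym (begin
  recip r * (recip (rising (suc n) r) - recip (rising (suc (suc n)) r))
    ≡⟨ cong₂ (λ a b → recip r * (a - b)) front back ⟩
  recip r * (ℕ→ℚ (suc n ℕ.+ r) * X - ℕ→ℚ (suc n) * X)
    ≡⟨ cong (λ a → recip r * (a * X - ℕ→ℚ (suc n) * X)) (ℕ→ℚ-+ (suc n) r) ⟩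
  recip r * ((ℕ→ℚ (suc n) + ℕ→ℚ r) * X - ℕ→ℚ (suc n) * X)
    ≡⟨ solve 4 (λ ρ a b x → ρ :* ((a :+ b) :* x :- a :* x) := (b :* ρ) :* x) refl (recip r) (ℕ→ℚ (suc n)) (ℕ→ℚ r) X ⟩
  (ℕ→ℚ r * recip r) * X
    ≡⟨ cong (_* X) (ℕ→ℚ*recip≡1 r) ⟩
  1ℚ * X
    ≡⟨ *-identityˡ X ⟩
  X ∎)
  where
  X : ℚ
  X = recip (rising (suc n) (suc r))

  front : recip (rising (suc n) r) ≡ ℕ→ℚ (suc n ℕ.+ r) * X
  front = recip≡ℕ→ℚ*recip[*] (rising (suc n) r) (suc n ℕ.+ r) {{rising-nonZero n r}}

  back : recip (rising (suc (suc n)) r) ≡ ℕ→ℚ (suc n) * X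
  back = trans (recip≡ℕ→ℚ*recip[*] (rising (suc (suc n)) r) (suc n) {{rising-nonZero (suc n) r}})
               (cong (λ t → ℕ→ℚ (suc n) * recip t) (trans (ℕ.*-comm _ (suc n)) (rising-shift (suc n) r)))

Σ₁-k!/rising≡ : ∀ r .{{r≢0 : ℕ.NonZero r}} N →
  Σ₁ N (λ n → ℕ→ℚ (suc r !) * recip (rising n (suc r))) ≡
  ℕ→ℚ (suc r) * recip r - ℕ→ℚ (suc r !) * recip (r ℕ.* rising (suc N) r)
Σ₁-k!/rising≡ r {{r≢0}} N = begin
  Σ₁ N (λ n → ℕ→ℚ (suc r !) * recip (rising n (suc r)))   ≡⟨ Σ₁-cong N term ⟩
  Σ₁ N (λ n → g n - g (suc n))                            ≡⟨ Σ₁-telescope N g ⟩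
  g 1 - g (suc N)                                         ≡⟨ cong₂ _-_ g1 g[1+N] ⟩
  ℕ→ℚ (suc r) * recip r - ℕ→ℚ (suc r !) * recip (r ℕ.* rising (suc N) r) ∎
  where
  g : ℕ → ℚ
  g n = (ℕ→ℚ (suc r !) * recip r) * recip (rising n r)

  term : ∀ n → ℕ→ℚ (suc r !) * recip (rising (suc n) (suc r)) ≡ g (suc n) - g (suc (suc n))
  term n = trans (cong (ℕ→ℚ (suc r !) *_) (recip-rising-telescope r n))
    (solve 4 (λ f ρ a b → f :* (ρ :* (a :- b)) := (f :* ρ) :* a :- (f :* ρ) :* b) refl
       (ℕ→ℚ (suc r !)) (recip r) (recip (rising (suc n) r)) (recip (rising (suc (suc n)) r)))

  g1 : g 1 ≡ ℕ→ℚ (suc r) * recip r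
  g1 = begin
    (ℕ→ℚ (suc r ℕ.* r !) * recip r) * recip (rising 1 r)
      ≡⟨ cong₂ (λ a b → (a * recip r) * recip b) (ℕ→ℚ-* (suc r) (r !)) (rising-1 r) ⟩
    (ℕ→ℚ (suc r) * ℕ→ℚ (r !) * recip r) * recip (r !)
      ≡⟨ solve 4 (λ a b ρ β → (a :* b :* ρ) :* β := (a :* ρ) :* (b :* β)) refl (ℕ→ℚ (suc r)) (ℕ→ℚ (r !)) (recip r) (recip (r !)) ⟩
    (ℕ→ℚ (suc r) * recip r) * (ℕ→ℚ (r !) * recip (r !))
      ≡⟨ cong ((ℕ→ℚ (suc r) * recip r) *_) (ℕ→ℚ*recip≡1 (r !) {{r ℕ.!≢0}}) ⟩
    (ℕ→ℚ (suc r) * recip r) * 1ℚ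
      ≡⟨ *-identityʳ _ ⟩
    ℕ→ℚ (suc r) * recip r ∎

  g[1+N] : g (suc N) ≡ ℕ→ℚ (suc r !) * recip (r ℕ.* rising (suc N) r)
  g[1+N] = trans (*-assoc (ℕ→ℚ (suc r !)) (recip r) _)
                 (cong (ℕ→ℚ (suc r !) *_) (sym (recip-* r (rising (suc N) r) {{r≢0}} {{rising-nonZero N r}})))

-- Convergence

convergesTo-cong : ∀ {s t : ℕ → ℚ} {L} → (∀ N → s N ≡ t N) → ConvergesTo t L → ConvergesTo s L
convergesTo-cong {L = L} s≡t t→L ε ε>0 with t→L ε ε>0
... | N , close = N , λ M N≤M → subst (λ x → ∣ x - L ∣ < ε) (sym (s≡t M)) (close M N≤M)

convergesTo-if-error≤ : ∀ {s : ℕ → ℚ} {L} c → (∀ N → ∣ s N - L ∣ ≤ + c / suc N) → ConvergesTo s L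
convergesTo-if-error≤ c error≤ ε@(mkℚ (+ suc p) d _) _ = c ℕ.* suc d , λ M c[1+d]≤M →
  ≤-<-trans (error≤ M) (subst (+ c / suc M <_) (↥p/↧p≡p ε)
    (a*e<b*d⇒a/d<b/e c (suc p) (suc M) (suc d) (ℕ.≤-trans (s≤s c[1+d]≤M) (ℕ.m≤n*m (suc M) (suc p)))))
convergesTo-if-error≤ c error≤ (mkℚ (+ zero)    d _) ε>0 = ⊥-elim (ℤ.Positive.pos (positive ε>0))
convergesTo-if-error≤ c error≤ (mkℚ ℤ.-[1+ n ] d _) ε>0 = ⊥-elim (ℤ.Positive.pos (positive ε>0))

Σ₁-k!/rising-converges : ∀ r .{{r≢0 : ℕ.NonZero r}} →
  ConvergesTo (λ N → Σ₁ N (λ n → ℕ→ℚ (suc r !) * recip (rising n (suc r)))) (ℕ→ℚ (suc r) * recip r)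
Σ₁-k!/rising-converges r {{r≢0}} = convergesTo-if-error≤ {s} (suc r !) error≤
  where
  s : ℕ → ℚ
  s N = Σ₁ N (λ n → ℕ→ℚ (suc r !) * recip (rising n (suc r)))

  L : ℚ
  L = ℕ→ℚ (suc r) * recip r

  D : ℕ → ℕ
  D N = r ℕ.* rising (suc N) r

  instance
    D-nonZero : ∀ {N} → ℕ.NonZero (D N)
    D-nonZero {N} = ℕ.m*n≢0 r (rising (suc N) r) {{r≢0}} {{rising-nonZero N r}}

  error≡ : ∀ N → ∣ s N - L ∣ ≡ + (suc r !) / D N
  error≡ N = begin
    ∣ s N - L ∣                                          ≡⟨ cong (λ x → ∣ x - L ∣) (Σ₁-k!/rising≡ r N) ⟩
    ∣ (L - ℕ→ℚ (suc r !) * recip (D N)) - L ∣            ≡⟨ cong ∣_∣ (solve 2 (λ a b → (a :- b) :- a := :- b) refl L _) ⟩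
    ∣ - (ℕ→ℚ (suc r !) * recip (D N)) ∣                  ≡⟨ ∣-p∣≡∣p∣ _ ⟩
    ∣ ℕ→ℚ (suc r !) * recip (D N) ∣                      ≡⟨ cong ∣_∣ (a/d≡ℕ→ℚa*recipd (suc r !) (D N)) ⟨
    ∣ + (suc r !) / D N ∣                                ≡⟨ 0≤p⇒∣p∣≡p (nonNegative⁻¹ _ {{normalize-nonNeg (suc r !) (D N)}}) ⟩
    + (suc r !) / D N                                    ∎

  error≤ : ∀ N → ∣ s N - L ∣ ≤ + (suc r !) / suc N
  error≤ N = subst (_≤ + (suc r !) / suc N) (sym (error≡ N))
    (a*e≤b*d⇒a/d≤b/e (suc r !) (suc r !) (D N) (suc N) (ℕ.*-monoʳ-≤ (suc r !) 1+N≤D))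
    where
    1+N≤D : suc N ℕ.≤ D N
    1+N≤D = ℕ.≤-trans (n≤rising N r) (ℕ.m≤n*m (rising (suc N) r) r)

corollary2p8 : (k : ℕ) → 1 ℕ.< k →
    ConvergesTo (λ N → Σ₁ N (λ n → recip (T k n))) (Σ₁ k (λ j → C j * fallingℚ k j))
    × ConvergesTo (λ N → Σ₁ N (λ n → ℕ→ℚ (k !) * recip (rising n k))) (Σ₁ k (λ j → C j * fallingℚ k j))
corollary2p8 zero          ()
corollary2p8 (suc zero)    (s≤s ())
corollary2p8 (suc (suc m)) _ = convergesTo-cong (λ N → Σ₁-cong N (recip-T k)) series , series
  where
  k : ℕ
  k = suc (suc m)

  partialSums : ℕ → ℚ
  partialSums N = Σ₁ N (λ n → ℕ→ℚ (k !) * recip (rising n k))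

  series : ConvergesTo partialSums (Σ₁ k (λ j → C j * fallingℚ k j))
  series = subst (ConvergesTo partialSums) (sym (Σ₁-C*fallingℚ m)) (Σ₁-k!/rising-converges (suc m))
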